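{- The $G$-orbits of elements of rank two in $M(n,1)$ are in one-one correspondence with the conjugacy classes of derangements of $\{1,\dots,n\}$ in $S_n$. Explicitly, every rank-two element of $M(n,1)$ lies in the orbit of $I+P_\sigma$ for some derangement $\sigma$, and for derangements $\sigma,\tau$ the matrices $I+P_\sigma$ and $I+P_\tau$ lie in the same $G$-orbit if and only if $\sigma$ and $\tau$ are conjugate in $S_n$.
   Context: $M(n,1)$ is the set of $n\times n$ matrices with entries in $\{0,1\}$ whose row and column sums all equal a common value $\rho(M)$, called the rank (line sum) of $M$. $P_\sigma$ is the permutation matrix of $\sigma\in S_n$ with $P_\sigma P_\tau=P_{\sigma\tau}$, and $I$ is the identity matrix. $G$ is the group of order $2(n!)^2$ of transformations of $n\times n$ matrices consisting of the maps $M\mapsto P_\sigma M P_\tau^{ -1}$ and $M\mapsto P_\sigma M^T P_\tau^{ -1}$ for $\sigma,\tau\in S_n$ (generated by row permutations, column permutations and transpose). A derangement is a permutation with no fixed points. -}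

module Defs where

open import Data.Nat using (ℕ; zero; suc; _+_)
open import Data.Fin using (Fin; _≟_)
open import Data.List using (map; allFin)
open import Data.Nat.ListAction using (sum)
open import Data.Product using (Σ; ∃; _×_; _,_)
open import Data.Sum using (_⊎_)
open import Relation.Nullary using (¬_; does)
open import Relation.Binary.PropositionalEquality using (_≡_)
open import Data.Bool using (if_then_else_)
open import Data.Fin.Permutation using (Permutation′; _⟨$⟩ʳ_; _⟨$⟩ˡ_)

Matrix : ℕ → Set
Matrix n = Fin n → Fin n → ℕ

_≈_ : ∀ {n} → Matrix n → Matrix n → Set
_≈_ {n} A B = ∀ (i j : Fin n) → A i j ≡ B i j

Σ[_] : ∀ n → (Fin n → ℕ) → ℕ
Σ[ n ] f = sum (map f (allFin n))

IsZeroOne : ∀ {n} → Matrix n → Set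
IsZeroOne {n} M = ∀ (i j : Fin n) → M i j ≡ 0 ⊎ M i j ≡ 1

HasLineSum : ∀ {n} → Matrix n → ℕ → Set
HasLineSum {n} M r =
  (∀ i → Σ[ n ] (λ j → M i j) ≡ r) × (∀ j → Σ[ n ] (λ i → M i j) ≡ r)

InM1WithRank : ∀ {n} → Matrix n → ℕ → Set
InM1WithRank M r = IsZeroOne M × HasLineSum M r

I : ∀ {n} → Matrix n
I i j = if does (i ≟ j) then 1 else 0

-- permutation matrix: (P σ) i j = 1 iff i = σ j, so that P σ · P τ = P (σ ∘ τ)
P : ∀ {n} → Permutation′ n → Matrix n
P σ i j = if does (i ≟ σ ⟨$⟩ʳ j) then 1 else 0

_⊕_ : ∀ {n} → Matrix n → Matrix n → Matrix n
(A ⊕ B) i j = A i j + B i j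

transpose : ∀ {n} → Matrix n → Matrix n
transpose M i j = M j i

-- P σ · M · (P τ)⁻¹, computed entrywise: entry (i,j) is M (σ⁻¹ i) (τ⁻¹ j)
act : ∀ {n} → Permutation′ n → Permutation′ n → Matrix n → Matrix n
act σ τ M i j = M (σ ⟨$⟩ˡ i) (τ ⟨$⟩ˡ j)

SameGOrbit : ∀ {n} → Matrix n → Matrix n → Set
SameGOrbit {n} A B =
  Σ (Permutation′ n) λ σ → Σ (Permutation′ n) λ τ →
    (B ≈ act σ τ A) ⊎ (B ≈ act σ τ (transpose A))

Derangement : ∀ {n} → Permutation′ n → Set
Derangement {n} σ = ∀ (i : Fin n) → ¬ (σ ⟨$⟩ʳ i ≡ i)

Conjugate : ∀ {n} → Permutation′ n → Permutation′ n → Set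
Conjugate {n} σ τ =
  Σ (Permutation′ n) λ π → ∀ (i : Fin n) → τ ⟨$⟩ʳ (π ⟨$⟩ʳ i) ≡ π ⟨$⟩ʳ (σ ⟨$⟩ʳ i)

-- An element M of rank two in M(n,1) is the incidence matrix of a 2-regular bipartite graph
-- between rows and columns. Its edges carry two fixed-point-free involutions (the other edge in
-- the same column, the other edge in the same row); every cycle alternates between them, so it has
-- even length and can be 2-coloured alternately. Each colour class is a perfect matching, so
-- M = P α + P β with α j ≠ β j for all j, and permuting rows by α⁻¹ turns M into I + P (α⁻¹ β).
--
-- Conversely, if I + P σ and I + P τ lie in one orbit, comparing the two supports row by row shows
-- that a conjugate of τ⁻¹ agrees with σ⁻¹ on a σ-invariant set and with σ off it. Every permutation
-- is conjugate to its inverse by an involution that reflects each of its cycles about a chosen point;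
-- applying this reflection on the invariant set only shows that σ is conjugate to τ⁻¹, hence to τ.

{-# OPTIONS --safe #-}
module Submission where

open import Defs
open import Data.Bool using (Bool; true; false; not; if_then_else_)
open import Data.Bool.Properties using (not-involutive; not-¬; ¬-not) renaming (_≟_ to _≟ᵇ_)
open import Data.Fin using (Fin; toℕ; combine; _≟_) renaming (zero to fzero; suc to fsuc)
open import Data.Fin.Permutation using (Permutation′; _⟨$⟩ʳ_; _⟨$⟩ˡ_; inverseˡ; inverseʳ; permutation; flip; _∘ₚ_)
import Data.Fin.Permutation as Perm
open import Data.Fin.Properties
  using (pigeonhole; suc-injective; toℕ-injective; toℕ≤pred[n]; combine-injective)
open import Data.List using (List; map; upTo)
open import Data.List.Extrema.Nat using (argmin; argmin-sel; f[argmin]≤f[xs])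
open import Data.List.Membership.Propositional using (_∈_)
open import Data.List.Membership.Propositional.Properties using (∈-map⁺; ∈-map⁻; ∈-upTo⁺)
open import Data.List.Properties using (map-tabulate)
import Data.List.Relation.Unary.All as All
open import Data.Nat using (ℕ; zero; suc; _+_; _*_; _∸_; _≤_; _<_; _<?_; NonZero)
open import Data.Nat.DivMod using (_%_; _/_; m≡m%n+[m/n]*n; m%n<n)
open import Data.Nat.ListAction using (sum)
open import Data.Nat.Properties
  using (+-comm; +-suc; *-suc; +-cancelˡ-≡; m+n≡0⇒m≡0; m+n≡0⇒n≡0; ≤-antisym; ≤-trans; <⇒≤;
         n<1+n; m∸n≤m; m<n⇒0<n∸m; m+[n∸m]≡n; <-cmp; <-asym; ≡-irrelevant)
open import Data.Product using (Σ; _×_; ∃; ∃-syntax; _,_; proj₁; proj₂)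
open import Data.Sum using (_⊎_; inj₁; inj₂; [_,_])
import Data.Sum as Sum
open import Function using (_∘_)
open import Function.Bundles using (_⇔_; _↔_; Inverse; mk↔ₛ′; mk⇔; Equivalence)
open import Function.Construct.Composition using (_↔-∘_)
open import Function.Construct.Symmetry using (↔-sym)
open import Relation.Binary.Definitions using (tri<; tri≈; tri>)
open import Relation.Binary.PropositionalEquality
  using (_≡_; _≢_; refl; sym; trans; cong; cong₂; cong-app; subst; module ≡-Reasoning)
open import Relation.Nullary using (¬_; Dec; yes; no; does; contradiction)
open import Relation.Nullary.Decidable using (dec-true; dec-false)

halve : ∀ k → ∃[ t ] (k ≡ t + t ⊎ k ≡ t + suc t)
halve zero = 0 , inj₁ refl
halve (suc k) with halve k
... | t , inj₁ refl = t , inj₂ (sym (+-suc t t))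
... | t , inj₂ refl = suc t , inj₁ refl

<?-flip : ∀ {m n} → m ≢ n → does (n <? m) ≡ not (does (m <? n))
<?-flip {m} {n} m≢n with <-cmp m n
... | tri< m<n _ _ rewrite dec-true (m <? n) m<n = dec-false (n <? m) (<-asym m<n)
... | tri≈ _ m≡n _ = contradiction m≡n m≢n
... | tri> _ _ n<m rewrite dec-false (m <? n) (<-asym n<m) = dec-true (n <? m) n<m

module Iteration {A : Set} where

  open import Function.Endo.Propositional A public using (_^_)
  open import Function.Endo.Propositional A using (^-homo)

  ^-+ : ∀ (f : A → A) k l x → (f ^ (k + l)) x ≡ (f ^ k) ((f ^ l) x)
  ^-+ f k l = cong-app (^-homo f k l)

  ^-intertwine : ∀ {f g h : A → A} → (∀ x → h (f x) ≡ g (h x)) →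
                 ∀ k x → h ((f ^ k) x) ≡ (g ^ k) (h x)
  ^-intertwine eq zero x = refl
  ^-intertwine {f} {g} eq (suc k) x = trans (eq ((f ^ k) x)) (cong g (^-intertwine eq k x))

  ^-comm : ∀ (f : A → A) k l x → (f ^ k) ((f ^ l) x) ≡ (f ^ l) ((f ^ k) x)
  ^-comm f k l x = begin
    (f ^ k) ((f ^ l) x)  ≡⟨ ^-+ f k l x ⟨
    (f ^ (k + l)) x      ≡⟨ cong (λ i → (f ^ i) x) (+-comm k l) ⟩
    (f ^ (l + k)) x      ≡⟨ ^-+ f l k x ⟩
    (f ^ l) ((f ^ k) x)  ∎
    where open ≡-Reasoning

  ^-cancel : ∀ {f g : A → A} → (∀ x → g (f x) ≡ x) → ∀ k x → (g ^ k) ((f ^ k) x) ≡ x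
  ^-cancel inv zero x = refl
  ^-cancel {f} {g} inv (suc k) x = begin
    g ((g ^ k) (f ((f ^ k) x)))  ≡⟨ ^-intertwine {f = g} {g} {g} (λ _ → refl) k _ ⟩
    (g ^ k) (g (f ((f ^ k) x)))  ≡⟨ cong (g ^ k) (inv _) ⟩
    (g ^ k) ((f ^ k) x)          ≡⟨ ^-cancel inv k x ⟩
    x                            ∎
    where open ≡-Reasoning

  ^-periodic : ∀ (f : A → A) {p x} → (f ^ p) x ≡ x → ∀ t → (f ^ (t * p)) x ≡ x
  ^-periodic f fᵖx≡x zero = refl
  ^-periodic f {p} {x} fᵖx≡x (suc t) =
    trans (^-+ f p (t * p) x) (trans (cong (f ^ p) (^-periodic f fᵖx≡x t)) fᵖx≡x)

  ^-mod : ∀ (f : A → A) {p x} .{{_ : NonZero p}} → (f ^ p) x ≡ x →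
          ∀ k → (f ^ k) x ≡ (f ^ (k % p)) x
  ^-mod f {p} {x} fᵖx≡x k = begin
    (f ^ k) x                                ≡⟨ cong (λ i → (f ^ i) x) (m≡m%n+[m/n]*n k p) ⟩
    (f ^ (k % p + k / p * p)) x              ≡⟨ ^-+ f (k % p) (k / p * p) x ⟩
    (f ^ (k % p)) ((f ^ (k / p * p)) x)      ≡⟨ cong (f ^ (k % p)) (^-periodic f fᵖx≡x (k / p)) ⟩
    (f ^ (k % p)) x                          ∎
    where open ≡-Reasoning

open Iteration

-- Conjugate σ τ (from Defs) is definitionally Conjugateᶠ (σ ⟨$⟩ʳ_) (τ ⟨$⟩ʳ_).
Conjugateᶠ : {A : Set} → (A → A) → (A → A) → Set
Conjugateᶠ {A} f g = Σ (A ↔ A) λ π → ∀ x → g (Inverse.to π x) ≡ Inverse.to π (f x)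

conjugateᶠ-sym : ∀ {A : Set} {f g : A → A} → Conjugateᶠ f g → Conjugateᶠ g f
conjugateᶠ-sym {f = f} {g} (π , gπ≡πf) = ↔-sym π , λ x → begin
  f (from x)              ≡⟨ strictlyInverseʳ _ ⟨
  from (to (f (from x)))  ≡⟨ cong from (gπ≡πf (from x)) ⟨
  from (g (to (from x)))  ≡⟨ cong (from ∘ g) (strictlyInverseˡ x) ⟩
  from (g x)              ∎
  where open Inverse π
        open ≡-Reasoning

conjugateᶠ-trans : ∀ {A : Set} {f g h : A → A} → Conjugateᶠ f g → Conjugateᶠ g h → Conjugateᶠ f h
conjugateᶠ-trans (π , gπ≡πf) (ρ , hρ≡ρg) =
  ρ ↔-∘ π , λ x → trans (hρ≡ρg (Inverse.to π x)) (cong (Inverse.to ρ) (gπ≡πf x))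

module Orbits {A : Set} {m : ℕ} (enc : A → Fin m)
  (enc-injective : ∀ {x y} → enc x ≡ enc y → x ≡ y) (π : A ↔ A) where

  open Inverse π using (to; from; strictlyInverseˡ; strictlyInverseʳ)

  infix 4 _∼_
  _∼_ : A → A → Set
  x ∼ y = ∃[ k ] (to ^ k) x ≡ y

  ^-injective : ∀ k {x y} → (to ^ k) x ≡ (to ^ k) y → x ≡ y
  ^-injective k {x} {y} eq = begin
    x                       ≡⟨ ^-cancel strictlyInverseʳ k x ⟨
    (from ^ k) ((to ^ k) x) ≡⟨ cong (from ^ k) eq ⟩
    (from ^ k) ((to ^ k) y) ≡⟨ ^-cancel strictlyInverseʳ k y ⟩
    y                       ∎
    where open ≡-Reasoning

  period : ∀ x → ∃[ q ] q < m × (to ^ suc q) x ≡ x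
  period x with i , j , i<j , eq ← pigeonhole (n<1+n m) (λ i → enc ((to ^ toℕ i) x)) =
    positive (m<n⇒0<n∸m i<j) (≤-trans (m∸n≤m (toℕ j) (toℕ i)) (toℕ≤pred[n] j)) periodic
    where
    periodic : (to ^ (toℕ j ∸ toℕ i)) x ≡ x
    periodic = ^-injective (toℕ i) (begin
      (to ^ toℕ i) ((to ^ (toℕ j ∸ toℕ i)) x) ≡⟨ ^-+ to (toℕ i) _ x ⟨
      (to ^ (toℕ i + (toℕ j ∸ toℕ i))) x      ≡⟨ cong (λ k → (to ^ k) x) (m+[n∸m]≡n (<⇒≤ i<j)) ⟩
      (to ^ toℕ j) x                          ≡⟨ enc-injective eq ⟨
      (to ^ toℕ i) x                          ∎)
      where open ≡-Reasoning
    positive : ∀ {p} → 0 < p → p ≤ m → (to ^ p) x ≡ x → ∃[ q ] q < m × (to ^ suc q) x ≡ x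
    positive {suc q} _ q<m eq = q , q<m , eq

  ∼-trans : ∀ {x y z} → x ∼ y → y ∼ z → x ∼ z
  ∼-trans {x} (k , refl) (l , refl) = l + k , ^-+ to l k x

  -- If the period of x is q + 1, then going k * q steps further from (to ^ k) x returns to x.
  ∼-sym : ∀ {x y} → x ∼ y → y ∼ x
  ∼-sym {x} (k , refl) with q , _ , periodic ← period x = k * q , (begin
    (to ^ (k * q)) ((to ^ k) x) ≡⟨ ^-+ to (k * q) k x ⟨
    (to ^ (k * q + k)) x        ≡⟨ cong (λ i → (to ^ i) x) (trans (+-comm (k * q) k) (sym (*-suc k q))) ⟩
    (to ^ (k * suc q)) x        ≡⟨ ^-periodic to periodic k ⟩
    x                           ∎)
    where open ≡-Reasoning

  ∼-to : ∀ x → x ∼ to x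
  ∼-to x = 1 , refl

  key : A → ℕ
  key = toℕ ∘ enc

  orbit : A → List A
  orbit x = map (λ k → (to ^ k) x) (upTo m)

  rep : A → A
  rep x = argmin key x (orbit x)

  ∼-rep : ∀ x → x ∼ rep x
  ∼-rep x with argmin-sel key x (orbit x)
  ... | inj₁ rep≡x = 0 , sym rep≡x
  ... | inj₂ rep∈orbit with k , _ , rep≡ ← ∈-map⁻ (λ k → (to ^ k) x) rep∈orbit = k , sym rep≡

  rep-least : ∀ {x y} → x ∼ y → key (rep x) ≤ key y
  rep-least {x} (k , refl) with q , q<m , periodic ← period x =
    All.lookup (f[argmin]≤f[xs] {f = key} x (orbit x))
      (subst (_∈ orbit x) (sym (^-mod to periodic k))
        (∈-map⁺ (λ k → (to ^ k) x) (∈-upTo⁺ (≤-trans (m%n<n k (suc q)) q<m))))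

  rep-cong : ∀ {x y} → x ∼ y → rep x ≡ rep y
  rep-cong {x} {y} x∼y = enc-injective (toℕ-injective (≤-antisym
    (rep-least (∼-trans x∼y (∼-rep y)))
    (rep-least (∼-trans (∼-sym x∼y) (∼-rep x)))))

  -- Reflecting an orbit about its representative r sends (from ^ k) r to (to ^ k) r.
  reflect : A → A
  reflect x = (to ^ proj₁ (∼-rep x)) (rep x)

  reflect-witness : ∀ {x} k → (to ^ k) x ≡ rep x → reflect x ≡ (to ^ k) (rep x)
  reflect-witness {x} k reaches = begin
    (to ^ l) (rep x)       ≡⟨ cong (to ^ l) reaches ⟨
    (to ^ l) ((to ^ k) x)  ≡⟨ ^-comm to l k x ⟩
    (to ^ k) ((to ^ l) x)  ≡⟨ cong (to ^ k) (proj₂ (∼-rep x)) ⟩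
    (to ^ k) (rep x)       ∎
    where
    open ≡-Reasoning
    l = proj₁ (∼-rep x)

  reflect-to : ∀ x → reflect (to x) ≡ from (reflect x)
  reflect-to x = begin
    (to ^ l) (rep (to x))          ≡⟨ cong (to ^ l) (rep-cong (∼-to x)) ⟨
    (to ^ l) (rep x)               ≡⟨ strictlyInverseʳ _ ⟨
    from (to ((to ^ l) (rep x)))   ≡⟨ cong from (reflect-witness (suc l) reaches) ⟨
    from (reflect x)               ∎
    where
    open ≡-Reasoning
    l = proj₁ (∼-rep (to x))
    reaches : to ((to ^ l) x) ≡ rep x
    reaches = trans (^-intertwine {f = to} {to} {to} (λ _ → refl) l x)
                    (trans (proj₂ (∼-rep (to x))) (sym (rep-cong (∼-to x))))

  reflect-rep : ∀ x → reflect (rep x) ≡ rep x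
  reflect-rep x = trans (reflect-witness 0 rep≡) (sym rep≡)
    where
    rep≡ : rep x ≡ rep (rep x)
    rep≡ = rep-cong (∼-rep x)

  reflect-involutive : ∀ x → reflect (reflect x) ≡ x
  reflect-involutive x = begin
    reflect ((to ^ k) (rep x))   ≡⟨ ^-intertwine reflect-to k (rep x) ⟩
    (from ^ k) (reflect (rep x)) ≡⟨ cong (from ^ k) (reflect-rep x) ⟩
    (from ^ k) (rep x)           ≡⟨ cong (from ^ k) (proj₂ (∼-rep x)) ⟨
    (from ^ k) ((to ^ k) x)      ≡⟨ ^-cancel strictlyInverseʳ k x ⟩
    x                            ∎
    where
    open ≡-Reasoning
    k = proj₁ (∼-rep x)

  ∼-reflect : ∀ x → x ∼ reflect x
  ∼-reflect x = ∼-trans (∼-rep x) (proj₁ (∼-rep x) , refl)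

  conjugate-inverse : Conjugateᶠ to from
  conjugate-inverse =
    mk↔ₛ′ reflect reflect reflect-involutive reflect-involutive , λ x → sym (reflect-to x)

  module _ {T : A → Set} (T? : ∀ x → Dec (T x)) (T-to : ∀ {x} → T x → T (to x)) where

    T-∼ : ∀ {x y} → x ∼ y → T x → T y
    T-∼ (zero , refl) Tx = Tx
    T-∼ (suc k , refl) Tx = T-to (T-∼ (k , refl) Tx)

    patch : A → A
    patch x with T? x
    ... | yes _ = reflect x
    ... | no _  = x

    patch-in : ∀ {x} → T x → patch x ≡ reflect x
    patch-in {x} Tx with T? x
    ... | yes _  = refl
    ... | no ¬Tx = contradiction Tx ¬Tx

    patch-out : ∀ {x} → ¬ T x → patch x ≡ x
    patch-out {x} ¬Tx with T? x
    ... | yes Tx = contradiction Tx ¬Tx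
    ... | no _   = refl

    patch-involutive : ∀ x → patch (patch x) ≡ x
    patch-involutive x = by-cases (T? x)
      where
      by-cases : Dec (T x) → patch (patch x) ≡ x
      by-cases (yes Tx) = begin
        patch (patch x)     ≡⟨ cong patch (patch-in Tx) ⟩
        patch (reflect x)   ≡⟨ patch-in (T-∼ (∼-reflect x) Tx) ⟩
        reflect (reflect x) ≡⟨ reflect-involutive x ⟩
        x                   ∎
        where open ≡-Reasoning
      by-cases (no ¬Tx) = trans (cong patch (patch-out ¬Tx)) (patch-out ¬Tx)

    conjugate-piecewise : (h : A → A) → (∀ {x} → T x → h x ≡ from x) →
                          (∀ {x} → ¬ T (to x) → h x ≡ to x) → Conjugateᶠ to h
    conjugate-piecewise h h-in h-out =
      mk↔ₛ′ patch patch patch-involutive patch-involutive , intertwines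
      where
      intertwines : ∀ x → h (patch x) ≡ patch (to x)
      intertwines x = by-cases (T? x)
        where
        open ≡-Reasoning
        by-cases : Dec (T x) → h (patch x) ≡ patch (to x)
        by-cases (yes Tx) = begin
          h (patch x)      ≡⟨ cong h (patch-in Tx) ⟩
          h (reflect x)    ≡⟨ h-in (T-∼ (∼-reflect x) Tx) ⟩
          from (reflect x) ≡⟨ reflect-to x ⟨
          reflect (to x)   ≡⟨ patch-in (T-to Tx) ⟨
          patch (to x)     ∎
        by-cases (no ¬Tx) = begin
          h (patch x)  ≡⟨ cong h (patch-out ¬Tx) ⟩
          h x          ≡⟨ h-out ¬Tto ⟩
          to x         ≡⟨ patch-out ¬Tto ⟨
          patch (to x) ∎
          where
          ¬Tto : ¬ T (to x)
          ¬Tto = ¬Tx ∘ T-∼ (∼-sym (∼-to x))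

-- R ∘ C walks two steps at a time along the cycles of the graph with edges x — C x and x — R x,
-- so C maps each orbit of R ∘ C onto a different orbit; an orbit gets colour true when its
-- representative precedes that of its image under C.
module TwoColouring {A : Set} {m : ℕ} (enc : A → Fin m)
  (enc-injective : ∀ {x y} → enc x ≡ enc y → x ≡ y) (C R : A → A)
  (C-involutive : ∀ x → C (C x) ≡ x) (R-involutive : ∀ x → R (R x) ≡ x)
  (C-fixfree : ∀ x → C x ≢ x) (R-fixfree : ∀ x → R x ≢ x) where

  S : A ↔ A
  S = mk↔ₛ′ (R ∘ C) (C ∘ R)
    (λ x → trans (cong R (C-involutive (R x))) (R-involutive x))
    (λ x → trans (cong C (R-involutive (C x))) (C-involutive x))

  open Orbits enc enc-injective S
  open Inverse S using (to; from; strictlyInverseˡ; strictlyInverseʳ)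

  split-≡C : ∀ t l x → (to ^ (t + l)) x ≡ C x → (to ^ l) x ≡ C ((to ^ t) x)
  split-≡C t l x eq = begin
    (to ^ l) x                          ≡⟨ ^-cancel strictlyInverseʳ t _ ⟨
    (from ^ t) ((to ^ t) ((to ^ l) x))  ≡⟨ cong (from ^ t) (^-+ to t l x) ⟨
    (from ^ t) ((to ^ (t + l)) x)       ≡⟨ cong (from ^ t) eq ⟩
    (from ^ t) (C x)                    ≡⟨ ^-intertwine {f = to} {from} {C} (λ _ → refl) t x ⟨
    C ((to ^ t) x)                      ∎
    where open ≡-Reasoning

  -- C turns to into from, so (to ^ (t + t)) x ≡ C x would make (to ^ t) x a fixed point of C,
  -- and (to ^ (t + suc t)) x ≡ C x would make C ((to ^ t) x) a fixed point of R.
  ^-≢C : ∀ k x → (to ^ k) x ≢ C x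
  ^-≢C k x eq with halve k
  ... | t , inj₁ refl = C-fixfree ((to ^ t) x) (sym (split-≡C t t x eq))
  ... | t , inj₂ refl = R-fixfree (C ((to ^ t) x)) (split-≡C t (suc t) x eq)

  rep-≢ : ∀ x → rep x ≢ rep (C x)
  rep-≢ x rep≡ with k , eq ← ∼-trans (∼-rep x) (subst (_∼ C x) (sym rep≡) (∼-sym (∼-rep (C x))))
    = ^-≢C k x eq

  colour : A → Bool
  colour x = does (key (rep x) <? key (rep (C x)))

  colour-C : ∀ x → colour (C x) ≡ not (colour x)
  colour-C x = trans (cong (λ y → does (key (rep (C x)) <? key (rep y))) (C-involutive x))
                     (<?-flip (rep-≢ x ∘ enc-injective ∘ toℕ-injective))

  colour-to : ∀ x → colour (to x) ≡ colour x
  colour-to x = cong₂ (λ y z → does (key y <? key z))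
    (sym (rep-cong (∼-to x))) (rep-cong (1 , strictlyInverseˡ (C x)))

  colour-R : ∀ x → colour (R x) ≡ not (colour x)
  colour-R x = begin
    colour (R x)         ≡⟨ cong (colour ∘ R) (C-involutive x) ⟨
    colour (to (C x))    ≡⟨ colour-to (C x) ⟩
    colour (C x)         ≡⟨ colour-C x ⟩
    not (colour x)       ∎
    where open ≡-Reasoning

ZeroOne : ∀ {n} → (Fin n → ℕ) → Set
ZeroOne {n} h = ∀ (i : Fin n) → h i ≡ 0 ⊎ h i ≡ 1

Σ-suc : ∀ {n} (h : Fin (suc n) → ℕ) → Σ[ suc n ] h ≡ h fzero + Σ[ n ] (h ∘ fsuc)
Σ-suc {n} h = cong (λ hs → h fzero + sum hs)
  (trans (map-tabulate fsuc h) (sym (map-tabulate (λ i → i) (h ∘ fsuc))))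

Σ-tail : ∀ {n} (h : Fin (suc n) → ℕ) {c k} → h fzero ≡ c → Σ[ suc n ] h ≡ c + k →
         Σ[ n ] (h ∘ fsuc) ≡ k
Σ-tail h {c} h₀≡c Σ≡ = +-cancelˡ-≡ c _ _ (trans (sym (trans (Σ-suc h) (cong (_+ _) h₀≡c))) Σ≡)

Σ≡0⇒≡0 : ∀ {n} (h : Fin n → ℕ) → Σ[ n ] h ≡ 0 → ∀ i → h i ≡ 0
Σ≡0⇒≡0 h Σ≡0 fzero    = m+n≡0⇒m≡0 _ (trans (sym (Σ-suc h)) Σ≡0)
Σ≡0⇒≡0 h Σ≡0 (fsuc i) = Σ≡0⇒≡0 (h ∘ fsuc) (m+n≡0⇒n≡0 (h fzero) (trans (sym (Σ-suc h)) Σ≡0)) i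

Σ≡1⇒unique : ∀ {n} (h : Fin n → ℕ) → ZeroOne h → Σ[ n ] h ≡ 1 →
             ∃[ a ] h a ≡ 1 × (∀ i → h i ≡ 1 → i ≡ a)
Σ≡1⇒unique {suc n} h zo Σ≡1 with zo fzero
... | inj₁ h₀≡0 with a , ha≡1 , only-a ← Σ≡1⇒unique (h ∘ fsuc) (zo ∘ fsuc) (Σ-tail h h₀≡0 Σ≡1) =
  fsuc a , ha≡1 , λ where
    fzero h₀≡1 → contradiction (trans (sym h₀≡0) h₀≡1) λ ()
    (fsuc i) hi≡1 → cong fsuc (only-a i hi≡1)
... | inj₂ h₀≡1 = fzero , h₀≡1 , λ where
    fzero _ → refl
    (fsuc i) hi≡1 → contradiction (trans (sym (Σ≡0⇒≡0 (h ∘ fsuc) (Σ-tail h h₀≡1 Σ≡1) i)) hi≡1) λ ()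

record TwoOnes {n} (h : Fin n → ℕ) : Set where
  field
    first second : Fin n
    first≢second : first ≢ second
    first-one    : h first ≡ 1
    second-one   : h second ≡ 1
    only         : ∀ i → h i ≡ 1 → i ≡ first ⊎ i ≡ second

Σ≡2⇒twoOnes : ∀ {n} (h : Fin n → ℕ) → ZeroOne h → Σ[ n ] h ≡ 2 → TwoOnes h
Σ≡2⇒twoOnes {suc n} h zo Σ≡2 with zo fzero
... | inj₁ h₀≡0 = record
  { first = fsuc first ; second = fsuc second
  ; first≢second = first≢second ∘ suc-injective
  ; first-one = first-one ; second-one = second-one
  ; only = λ where
      fzero h₀≡1 → contradiction (trans (sym h₀≡0) h₀≡1) λ ()
      (fsuc i) hi≡1 → Sum.map (cong fsuc) (cong fsuc) (only i hi≡1) }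
  where open TwoOnes (Σ≡2⇒twoOnes (h ∘ fsuc) (zo ∘ fsuc) (Σ-tail h h₀≡0 Σ≡2))
... | inj₂ h₀≡1 with a , ha≡1 , only-a ← Σ≡1⇒unique (h ∘ fsuc) (zo ∘ fsuc) (Σ-tail h h₀≡1 Σ≡2) = record
  { first = fzero ; second = fsuc a ; first≢second = λ ()
  ; first-one = h₀≡1 ; second-one = ha≡1
  ; only = λ where
      fzero _ → inj₁ refl
      (fsuc i) hi≡1 → inj₂ (cong fsuc (only-a i hi≡1)) }

module _ {n} {h : Fin n → ℕ} (ones : TwoOnes h) where

  open TwoOnes ones

  partner : Fin n → Fin n
  partner i = if does (i ≟ first) then second else first

  partner-first : partner first ≡ second
  partner-first = cong (if_then second else first) (dec-true (first ≟ first) refl)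

  partner-second : partner second ≡ first
  partner-second = cong (if_then second else first) (dec-false (second ≟ first) (first≢second ∘ sym))

  partner-one : ∀ i → h (partner i) ≡ 1
  partner-one i with does (i ≟ first)
  ... | true  = second-one
  ... | false = first-one

  partner-≢ : ∀ {i} → h i ≡ 1 → partner i ≢ i
  partner-≢ {i} hi≡1 with only i hi≡1
  ... | inj₁ refl = λ eq → first≢second (sym (trans (sym partner-first) eq))
  ... | inj₂ refl = λ eq → first≢second (trans (sym partner-second) eq)

  partner-involutive : ∀ {i} → h i ≡ 1 → partner (partner i) ≡ i
  partner-involutive {i} hi≡1 with only i hi≡1
  ... | inj₁ refl = trans (cong partner partner-first) partner-second
  ... | inj₂ refl = trans (cong partner partner-second) partner-first

  self-or-partner : ∀ {i j} → h i ≡ 1 → h j ≡ 1 → j ≡ i ⊎ j ≡ partner i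
  self-or-partner {i} {j} hi≡1 hj≡1 with only i hi≡1 | only j hj≡1
  ... | inj₁ refl | inj₁ refl = inj₁ refl
  ... | inj₁ refl | inj₂ refl = inj₂ (sym partner-first)
  ... | inj₂ refl | inj₁ refl = inj₂ (sym partner-second)
  ... | inj₂ refl | inj₂ refl = inj₁ refl

record Edge {n} (M : Matrix n) : Set where
  constructor edge
  field
    row col : Fin n
    one     : M row col ≡ 1

open Edge

module _ {n} {M : Matrix n} where

  edge-≡ : ∀ {e e' : Edge M} → row e ≡ row e' → col e ≡ col e' → e ≡ e'
  edge-≡ {edge i j p} {edge .i .j q} refl refl = cong (edge i j) (≡-irrelevant p q)

  encode : Edge M → Fin (n * n)
  encode e = combine (row e) (col e)

  encode-injective : ∀ {e e'} → encode e ≡ encode e' → e ≡ e'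
  encode-injective {e} {e'} eq with rows≡ , cols≡ ← combine-injective (row e) (col e) (row e') (col e') eq
    = edge-≡ rows≡ cols≡

  swap : Edge M → Edge (transpose M)
  swap (edge i j p) = edge j i p

module ColumnMates {n} (M : Matrix n) (zo : IsZeroOne M)
  (colSums : ∀ j → Σ[ n ] (λ i → M i j) ≡ 2) where

  column : ∀ j → TwoOnes (λ i → M i j)
  column j = Σ≡2⇒twoOnes _ (λ i → zo i j) (colSums j)

  mate : Edge M → Edge M
  mate (edge i j _) = edge (partner (column j) i) j (partner-one (column j) i)

  mate-row-≢ : ∀ e → row (mate e) ≢ row e
  mate-row-≢ (edge i j p) = partner-≢ (column j) p

  mate-involutive : ∀ e → mate (mate e) ≡ e
  mate-involutive (edge i j p) = edge-≡ (partner-involutive (column j) p) refl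

  self-or-mate : ∀ {e e'} → col e' ≡ col e → e' ≡ e ⊎ e' ≡ mate e
  self-or-mate {edge i j p} {edge i' .j p'} refl =
    Sum.map (λ i'≡i → edge-≡ i'≡i refl) (λ i'≡ → edge-≡ i'≡ refl)
      (self-or-partner (column j) p p')

  some : Fin n → Edge M
  some j = edge (TwoOnes.first (column j)) j (TwoOnes.first-one (column j))

module Matching {E : Set} {n} (line : E → Fin n) (mate : E → E)
  (mate-line : ∀ e → line (mate e) ≡ line e)
  (self-or-mate : ∀ {e e'} → line e' ≡ line e → e' ≡ e ⊎ e' ≡ mate e)
  (some : Fin n → E) (some-line : ∀ k → line (some k) ≡ k)
  (colour : E → Bool) (colour-mate : ∀ e → colour (mate e) ≡ not (colour e)) where

  line-colour-injective : ∀ {e e'} → line e' ≡ line e → colour e' ≡ colour e → e' ≡ e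
  line-colour-injective {e} line≡ colour≡ with self-or-mate line≡
  ... | inj₁ e'≡e   = e'≡e
  ... | inj₂ refl   = contradiction (trans (sym (colour-mate e)) colour≡) (not-¬ refl ∘ sym)

  pick : Bool → Fin n → E
  pick b k = if does (colour (some k) ≟ᵇ b) then some k else mate (some k)

  pick-line : ∀ b k → line (pick b k) ≡ k
  pick-line b k with does (colour (some k) ≟ᵇ b)
  ... | true  = some-line k
  ... | false = trans (mate-line (some k)) (some-line k)

  pick-colour : ∀ b k → colour (pick b k) ≡ b
  pick-colour b k with colour (some k) ≟ᵇ b
  ... | yes c≡b = c≡b
  ... | no c≢b  = trans (colour-mate (some k)) (trans (cong not (¬-not c≢b)) (not-involutive b))

  pick-unique : ∀ {b} e → colour e ≡ b → pick b (line e) ≡ e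
  pick-unique {b} e refl = line-colour-injective (pick-line b (line e)) (pick-colour b (line e))

⟨$⟩ʳ≡⇔≡⟨$⟩ˡ : ∀ {n} (π : Permutation′ n) {i j} → π ⟨$⟩ʳ i ≡ j ⇔ i ≡ π ⟨$⟩ˡ j
⟨$⟩ʳ≡⇔≡⟨$⟩ˡ π = mk⇔ (λ { refl → sym (inverseˡ π) }) (λ { refl → inverseʳ π })

⟨$⟩ʳ-injective : ∀ {n} (π : Permutation′ n) {i j} → π ⟨$⟩ʳ i ≡ π ⟨$⟩ʳ j → i ≡ j
⟨$⟩ʳ-injective π {i} {j} eq = trans (sym (inverseˡ π)) (trans (cong (π ⟨$⟩ˡ_) eq) (inverseˡ π))

derangement-flip : ∀ {n} {σ : Permutation′ n} → Derangement σ → Derangement (flip σ)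
derangement-flip {σ = σ} σ-der i fixed = σ-der i (Equivalence.from (⟨$⟩ʳ≡⇔≡⟨$⟩ˡ σ) (sym fixed))

module _ {n} {i a : Fin n} where

  I-≡ : i ≡ a → I i a ≡ 1
  I-≡ i≡a = cong (if_then 1 else 0) (dec-true (i ≟ a) i≡a)

  I-≢ : i ≢ a → I i a ≡ 0
  I-≢ i≢a = cong (if_then 1 else 0) (dec-false (i ≟ a) i≢a)

I-cong : ∀ {n} {i a j b : Fin n} → i ≡ a ⇔ j ≡ b → I i a ≡ I j b
I-cong {i = i} {a} i≡a⇔j≡b with i ≟ a
... | yes i≡a = sym (I-≡ (Equivalence.to i≡a⇔j≡b i≡a))
... | no i≢a  = sym (I-≢ (i≢a ∘ Equivalence.from i≡a⇔j≡b))

I+I≢0⇔ : ∀ {n} {i a b : Fin n} → I i a + I i b ≢ 0 ⇔ (i ≡ a ⊎ i ≡ b)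
I+I≢0⇔ {i = i} {a} {b} = mk⇔ to from
  where
  to : I i a + I i b ≢ 0 → i ≡ a ⊎ i ≡ b
  to sum≢0 with i ≟ a | i ≟ b
  ... | yes i≡a | _       = inj₁ i≡a
  ... | no _    | yes i≡b = inj₂ i≡b
  ... | no _    | no _    = contradiction refl sum≢0
  from : i ≡ a ⊎ i ≡ b → I i a + I i b ≢ 0
  from (inj₁ i≡a) sum≡0 = contradiction (trans (sym (I-≡ i≡a)) (m+n≡0⇒m≡0 _ sum≡0)) λ ()
  from (inj₂ i≡b) sum≡0 = contradiction (trans (sym (I-≡ i≡b)) (m+n≡0⇒n≡0 _ sum≡0)) λ ()

zero-one-≡I+I : ∀ {n} {v} {i a b : Fin n} → v ≡ 0 ⊎ v ≡ 1 → a ≢ b →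
                v ≡ 1 ⇔ (i ≡ a ⊎ i ≡ b) → v ≡ I i a + I i b
zero-one-≡I+I {i = i} {a} {b} v01 a≢b v≡1⇔ with i ≟ a | i ≟ b
... | yes refl | yes refl = contradiction refl a≢b
... | yes i≡a  | no _     = Equivalence.from v≡1⇔ (inj₁ i≡a)
... | no _     | yes i≡b  = Equivalence.from v≡1⇔ (inj₂ i≡b)
... | no i≢a   | no i≢b   with v01
...   | inj₁ v≡0 = v≡0
...   | inj₂ v≡1 = contradiction (Equivalence.to v≡1⇔ v≡1) [ i≢a , i≢b ]

module RankTwo {n} (M : Matrix n) (zo : IsZeroOne M)
  (rowSums : ∀ i → Σ[ n ] (λ j → M i j) ≡ 2) (colSums : ∀ j → Σ[ n ] (λ i → M i j) ≡ 2) where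

  module Col = ColumnMates M zo colSums
  module Row = ColumnMates (transpose M) (λ i j → zo j i) rowSums

  rowMate : Edge M → Edge M
  rowMate e = swap (Row.mate (swap e))

  self-or-rowMate : ∀ {e e'} → row e' ≡ row e → e' ≡ e ⊎ e' ≡ rowMate e
  self-or-rowMate rows≡ = Sum.map (cong swap) (cong swap) (Row.self-or-mate rows≡)

  open TwoColouring encode encode-injective Col.mate rowMate
    Col.mate-involutive (λ e → cong swap (Row.mate-involutive (swap e)))
    (λ e → Col.mate-row-≢ e ∘ cong row) (λ e → Row.mate-row-≢ (swap e) ∘ cong col)
    using (colour; colour-C; colour-R)

  module ColMatching = Matching col Col.mate (λ _ → refl) Col.self-or-mate
    Col.some (λ _ → refl) colour colour-C
  module RowMatching = Matching row rowMate (λ _ → refl) self-or-rowMate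
    (swap ∘ Row.some) (λ _ → refl) colour colour-R

  matching : Bool → Permutation′ n
  matching b = permutation (row ∘ ColMatching.pick b) (col ∘ RowMatching.pick b)
    (λ i → trans (cong row (ColMatching.pick-unique _ (RowMatching.pick-colour b i)))
                 (RowMatching.pick-line b i))
    (λ j → trans (cong col (RowMatching.pick-unique _ (ColMatching.pick-colour b j)))
                 (ColMatching.pick-line b j))

  row≡matching : ∀ e → row e ≡ matching (colour e) ⟨$⟩ʳ col e
  row≡matching e = cong row (sym (ColMatching.pick-unique e refl))

  one-matching : ∀ b j → M (matching b ⟨$⟩ʳ j) j ≡ 1
  one-matching b j =
    subst (λ k → M (matching b ⟨$⟩ʳ j) k ≡ 1) (ColMatching.pick-line b j) (one (ColMatching.pick b j))

  matching-disjoint : ∀ j → matching true ⟨$⟩ʳ j ≢ matching false ⟨$⟩ʳ j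
  matching-disjoint j rows≡ = contradiction colours≡ λ ()
    where
    open ColMatching
    same : pick true j ≡ pick false j
    same = edge-≡ rows≡ (trans (pick-line true j) (sym (pick-line false j)))
    colours≡ : true ≡ false
    colours≡ = trans (sym (pick-colour true j)) (trans (cong colour same) (pick-colour false j))

  M≈P⊕P : M ≈ (P (matching true) ⊕ P (matching false))
  M≈P⊕P i j = zero-one-≡I+I (zo i j) (matching-disjoint j) (mk⇔ one⇒matched matched⇒one)
    where
    one⇒matched : M i j ≡ 1 → i ≡ matching true ⟨$⟩ʳ j ⊎ i ≡ matching false ⟨$⟩ʳ j
    one⇒matched p with colour (edge i j p) | row≡matching (edge i j p)
    ... | true  | i≡ = inj₁ i≡
    ... | false | i≡ = inj₂ i≡
    matched⇒one : i ≡ matching true ⟨$⟩ʳ j ⊎ i ≡ matching false ⟨$⟩ʳ j → M i j ≡ 1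
    matched⇒one (inj₁ refl) = one-matching true j
    matched⇒one (inj₂ refl) = one-matching false j

disjoint-sum⇒orbit : ∀ {n} {M : Matrix n} (α β : Permutation′ n) → (∀ j → α ⟨$⟩ʳ j ≢ β ⟨$⟩ʳ j) →
  M ≈ (P α ⊕ P β) → Derangement (β ∘ₚ flip α) × SameGOrbit M (I ⊕ P (β ∘ₚ flip α))
disjoint-sum⇒orbit {M = M} α β disjoint M≈ =
  (λ j fixed → disjoint j (Equivalence.from moveα (sym fixed))) ,
  flip α , Perm.id , inj₁ λ i j → sym (begin
    M (α ⟨$⟩ʳ i) j                                         ≡⟨ M≈ (α ⟨$⟩ʳ i) j ⟩
    I (α ⟨$⟩ʳ i) (α ⟨$⟩ʳ j) + I (α ⟨$⟩ʳ i) (β ⟨$⟩ʳ j)      ≡⟨ cong₂ _+_ (I-cong moveα) (I-cong moveα) ⟩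
    I i (α ⟨$⟩ˡ (α ⟨$⟩ʳ j)) + I i (α ⟨$⟩ˡ (β ⟨$⟩ʳ j))      ≡⟨ cong₂ _+_ (cong (I i) (inverseˡ α)) refl ⟩
    I i j + I i (α ⟨$⟩ˡ (β ⟨$⟩ʳ j))                        ∎)
  where
  open ≡-Reasoning
  moveα : ∀ {i j} → α ⟨$⟩ʳ i ≡ j ⇔ i ≡ α ⟨$⟩ˡ j
  moveα = ⟨$⟩ʳ≡⇔≡⟨$⟩ˡ α

rank-two⇒orbit : ∀ {n} (M : Matrix n) → InM1WithRank M 2 →
  Σ (Permutation′ n) λ σ → Derangement σ × SameGOrbit M (I ⊕ P σ)
rank-two⇒orbit M (zo , rowSums , colSums) =
  matching false ∘ₚ flip (matching true) ,
  disjoint-sum⇒orbit (matching true) (matching false) matching-disjoint M≈P⊕P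
  where open RankTwo M zo rowSums colSums

permutation-conjugate-inverse : ∀ {n} (σ : Permutation′ n) → Conjugateᶠ (σ ⟨$⟩ʳ_) (σ ⟨$⟩ˡ_)
permutation-conjugate-inverse σ = Orbits.conjugate-inverse (λ i → i) (λ eq → eq) σ

-- The support of I ⊕ P σ.
Adjacent : ∀ {n} → Permutation′ n → Fin n → Fin n → Set
Adjacent σ x y = x ≡ y ⊎ x ≡ σ ⟨$⟩ʳ y

-- With c = b⁻¹ ∘ a, the set T = {x | c x = x} is σ-invariant, and h = b⁻¹ ∘ τ⁻¹ ∘ b equals σ⁻¹
-- on T and σ off T; so σ is conjugate to h, which is conjugate to τ⁻¹ and hence to τ.
module AdjacencyConjugate {n} (σ τ a b : Permutation′ n)
  (σ-der : Derangement σ) (τ-der : Derangement τ)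
  (adj : ∀ x y → Adjacent τ (a ⟨$⟩ʳ x) (b ⟨$⟩ʳ y) ⇔ Adjacent σ x y) where

  c φ h : Fin n → Fin n
  c x = b ⟨$⟩ˡ (a ⟨$⟩ʳ x)
  φ x = b ⟨$⟩ˡ (τ ⟨$⟩ˡ (a ⟨$⟩ʳ x))
  h x = b ⟨$⟩ˡ (τ ⟨$⟩ˡ (b ⟨$⟩ʳ x))

  h∘c : ∀ x → h (c x) ≡ φ x
  h∘c x = cong (λ y → b ⟨$⟩ˡ (τ ⟨$⟩ˡ y)) (inverseʳ b)

  c-injective : ∀ {x y} → c x ≡ c y → x ≡ y
  c-injective = ⟨$⟩ʳ-injective a ∘ ⟨$⟩ʳ-injective (flip b)

  c≢φ : ∀ x → c x ≢ φ x
  c≢φ x = derangement-flip {σ = τ} τ-der (a ⟨$⟩ʳ x) ∘ sym ∘ ⟨$⟩ʳ-injective (flip b)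

  c-adjacent : ∀ x → Adjacent σ x (c x)
  c-adjacent x = Equivalence.to (adj x (c x)) (inj₁ (sym (inverseʳ b)))

  φ-adjacent : ∀ x → Adjacent σ x (φ x)
  φ-adjacent x = Equivalence.to (adj x (φ x))
    (inj₂ (sym (trans (cong (τ ⟨$⟩ʳ_) (inverseʳ b)) (inverseʳ τ))))

  c-or-φ-fixed : ∀ x → c x ≡ x ⊎ φ x ≡ x
  c-or-φ-fixed x with Equivalence.from (adj x x) (inj₁ refl)
  ... | inj₁ ax≡bx  = inj₁ (sym (Equivalence.to (⟨$⟩ʳ≡⇔≡⟨$⟩ˡ b) (sym ax≡bx)))
  ... | inj₂ ax≡τbx = inj₂ (sym (Equivalence.to (⟨$⟩ʳ≡⇔≡⟨$⟩ˡ b)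
                           (Equivalence.to (⟨$⟩ʳ≡⇔≡⟨$⟩ˡ τ) (sym ax≡τbx))))

  T : Fin n → Set
  T x = c x ≡ x

  T-σ : ∀ {x} → T x → T (σ ⟨$⟩ʳ x)
  T-σ {x} cx≡x with c-adjacent (σ ⟨$⟩ʳ x)
  ... | inj₁ σx≡cσx  = sym σx≡cσx
  ... | inj₂ σx≡σcσx =
    contradiction (c-injective (trans (sym (⟨$⟩ʳ-injective σ σx≡σcσx)) (sym cx≡x))) (σ-der x)

  h-in : ∀ {x} → T x → h x ≡ σ ⟨$⟩ˡ x
  h-in {x} cx≡x with φ-adjacent x
  ... | inj₁ x≡φx  = contradiction (trans cx≡x x≡φx) (c≢φ x)
  ... | inj₂ x≡σφx = trans (cong h (sym cx≡x))
                     (trans (h∘c x) (Equivalence.to (⟨$⟩ʳ≡⇔≡⟨$⟩ˡ σ) (sym x≡σφx)))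

  h-out : ∀ {z} → ¬ T (σ ⟨$⟩ʳ z) → h z ≡ σ ⟨$⟩ʳ z
  h-out {z} ¬T with c-adjacent (σ ⟨$⟩ʳ z) | c-or-φ-fixed (σ ⟨$⟩ʳ z)
  ... | inj₁ σz≡cσz  | _           = contradiction (sym σz≡cσz) ¬T
  ... | inj₂ _       | inj₁ Tσz    = contradiction Tσz ¬T
  ... | inj₂ σz≡σcσz | inj₂ φσz≡σz =
    trans (cong h (⟨$⟩ʳ-injective σ σz≡σcσz)) (trans (h∘c (σ ⟨$⟩ʳ z)) φσz≡σz)

  σ∼h : Conjugateᶠ (σ ⟨$⟩ʳ_) h
  σ∼h = Orbits.conjugate-piecewise (λ i → i) (λ eq → eq) σ (λ x → c x ≟ x) T-σ h h-in h-out

  h∼τ⁻¹ : Conjugateᶠ h (τ ⟨$⟩ˡ_)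
  h∼τ⁻¹ = b , λ x → sym (inverseʳ b)

  σ∼τ : Conjugate σ τ
  σ∼τ = conjugateᶠ-trans {g = τ ⟨$⟩ˡ_} {τ ⟨$⟩ʳ_} (conjugateᶠ-trans {g = h} {τ ⟨$⟩ˡ_} σ∼h h∼τ⁻¹)
                         (conjugateᶠ-sym (permutation-conjugate-inverse τ))

I-⟨$⟩ˡ : ∀ {n} (π : Permutation′ n) {i j} → I (π ⟨$⟩ˡ i) (π ⟨$⟩ˡ j) ≡ I i j
I-⟨$⟩ˡ π = I-cong (mk⇔ (⟨$⟩ʳ-injective (flip π)) (cong (π ⟨$⟩ˡ_)))

I⊕P-transpose : ∀ {n} (σ : Permutation′ n) → transpose (I ⊕ P σ) ≈ (I ⊕ P (flip σ))
I⊕P-transpose σ x y = cong₂ _+_ (I-cong {i = y} {x} (mk⇔ sym sym)) (I-cong {i = y} {σ ⟨$⟩ʳ x} move)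
  where
  move : y ≡ σ ⟨$⟩ʳ x ⇔ x ≡ σ ⟨$⟩ˡ y
  move = mk⇔ (Equivalence.to (⟨$⟩ʳ≡⇔≡⟨$⟩ˡ σ) ∘ sym) (sym ∘ Equivalence.from (⟨$⟩ʳ≡⇔≡⟨$⟩ˡ σ))

act-entries : ∀ {n} (A : Matrix n) {B : Matrix n} (a b : Permutation′ n) → B ≈ act a b A →
              ∀ x y → B (a ⟨$⟩ʳ x) (b ⟨$⟩ʳ y) ≡ A x y
act-entries A a b B≈ x y =
  trans (B≈ (a ⟨$⟩ʳ x) (b ⟨$⟩ʳ y)) (cong₂ A (inverseˡ a) (inverseˡ b))

entries⇒adjacency : ∀ {n} (σ τ a b : Permutation′ n) →
  (∀ x y → (I ⊕ P τ) (a ⟨$⟩ʳ x) (b ⟨$⟩ʳ y) ≡ (I ⊕ P σ) x y) →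
  ∀ x y → Adjacent τ (a ⟨$⟩ʳ x) (b ⟨$⟩ʳ y) ⇔ Adjacent σ x y
entries⇒adjacency σ τ a b entries x y = mk⇔
  (λ adjτ → Equivalence.to σ-side (Equivalence.from τ-side adjτ ∘ trans (entries x y)))
  (λ adjσ → Equivalence.to τ-side (Equivalence.from σ-side adjσ ∘ trans (sym (entries x y))))
  where
  τ-side = I+I≢0⇔ {i = a ⟨$⟩ʳ x} {b ⟨$⟩ʳ y} {τ ⟨$⟩ʳ (b ⟨$⟩ʳ y)}
  σ-side = I+I≢0⇔ {i = x} {y} {σ ⟨$⟩ʳ y}

orbit⇒conjugate : ∀ {n} (σ τ : Permutation′ n) → Derangement σ → Derangement τ →
  SameGOrbit (I ⊕ P σ) (I ⊕ P τ) → Conjugate σ τ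
orbit⇒conjugate σ τ σ-der τ-der (a , b , inj₁ ≈act) =
  AdjacencyConjugate.σ∼τ σ τ a b σ-der τ-der
    (entries⇒adjacency σ τ a b (act-entries (I ⊕ P σ) a b ≈act))
orbit⇒conjugate σ τ σ-der τ-der (a , b , inj₂ ≈act) =
  conjugateᶠ-trans {g = flip σ ⟨$⟩ʳ_} {τ ⟨$⟩ʳ_} (permutation-conjugate-inverse σ)
    (AdjacencyConjugate.σ∼τ (flip σ) τ a b (derangement-flip {σ = σ} σ-der) τ-der
      (entries⇒adjacency (flip σ) τ a b λ x y →
        trans (act-entries (transpose (I ⊕ P σ)) a b ≈act x y) (I⊕P-transpose σ x y)))

conjugate⇒orbit : ∀ {n} {σ τ : Permutation′ n} → Conjugate σ τ → SameGOrbit (I ⊕ P σ) (I ⊕ P τ)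
conjugate⇒orbit {σ = σ} {τ} (π , τπ≡πσ) = π , π , inj₁ λ i j →
  cong₂ _+_ (sym (I-⟨$⟩ˡ π)) (trans (sym (I-⟨$⟩ˡ π)) (cong (I (π ⟨$⟩ˡ i)) (π⁻¹τ≡σπ⁻¹ j)))
  where
  π⁻¹τ≡σπ⁻¹ : ∀ j → π ⟨$⟩ˡ (τ ⟨$⟩ʳ j) ≡ σ ⟨$⟩ʳ (π ⟨$⟩ˡ j)
  π⁻¹τ≡σπ⁻¹ j = sym (Equivalence.to (⟨$⟩ʳ≡⇔≡⟨$⟩ˡ π)
    (trans (sym (τπ≡πσ (π ⟨$⟩ˡ j))) (cong (τ ⟨$⟩ʳ_) (inverseʳ π))))

orbit⇔conjugate : ∀ {n} (σ τ : Permutation′ n) → Derangement σ → Derangement τ →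
  SameGOrbit (I ⊕ P σ) (I ⊕ P τ) ⇔ Conjugate σ τ
orbit⇔conjugate σ τ σ-der τ-der =
  mk⇔ (orbit⇒conjugate σ τ σ-der τ-der) (conjugate⇒orbit {σ = σ} {τ})

theorem4p4 : (n : ℕ) →
    ((M : Matrix n) → InM1WithRank M 2 →
      Σ (Permutation′ n) λ σ → Derangement σ × SameGOrbit M (I ⊕ P σ))
    × ((σ τ : Permutation′ n) → Derangement σ → Derangement τ →
      (SameGOrbit (I ⊕ P σ) (I ⊕ P τ) ⇔ Conjugate σ τ))
theorem4p4 n = rank-two⇒orbit , orbit⇔conjugate
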